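{- Let $r\ge 2$ and $t\ge 1$ be integers and let $\mathcal H$ be an $r$-uniform hypergraph with shadow graph $G$. (i) If $\mathcal H$ is Berge-$B_t$-free, then $G$ contains no copy of $B_{3rt}$ such that each of its $3rt$ triangles is the core of a Berge triangle in $\mathcal H$. (ii) If $\mathcal H$ is Berge-$F_t$-free, then $G$ contains no copy of $F_{3rt}$ such that each of its $3rt$ triangles is the core of a Berge triangle in $\mathcal H$.
   Context: For a graph $G$, a hypergraph $\mathcal H$ contains a Berge copy of $G$ if there is an injection of $V(G)$ into $V(\mathcal H)$ and an injective map $f$ from $E(G)$ to the hyperedges of $\mathcal H$ with each edge contained in its image; $\mathcal H$ is Berge-$F$-free if it contains no Berge copy of $F$. The shadow graph of $\mathcal H$ is the graph on $V(\mathcal H)$ in which $uv$ is an edge iff some hyperedge contains both $u$ and $v$. A triangle $uvw$ of the shadow graph is the core of a Berge triangle if there are three distinct hyperedges containing $\{u,v\}$, $\{v,w\}$, $\{u,w\}$ respectively. The book $B_s$ has vertices $u,v,w_1,\dots,w_s$ and edges $uv,uw_i,vw_i$ ($1\le i\le s$); its triangles are $uvw_i$. The fan $F_s$ has vertices $u,v_1,\dots,v_s,w_1,\dots,w_s$ and edges $uv_i,uw_i,v_iw_i$ ($1\le i\le s$); its triangles are $uv_iw_i$. -}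

module Defs where

open import Level using (0ℓ)
open import Data.Nat using (ℕ)
open import Data.Fin using (Fin)
open import Data.Fin.Subset using (Subset; _∈_; ∣_∣)
open import Data.Product using (Σ; _×_; _,_; proj₁; proj₂; ∃-syntax)
open import Relation.Binary.PropositionalEquality using (_≡_; _≢_)
open import Relation.Nullary using (¬_)
open import Function.Definitions using (Injective)

record Hypergraph : Set where
  field
    n        : ℕ
    m        : ℕ
    edge     : Fin m → Subset n
    distinct : Injective _≡_ _≡_ edge
open Hypergraph public

Uniform : ℕ → Hypergraph → Set
Uniform r H = ∀ (e : Fin (m H)) → ∣ edge H e ∣ ≡ r

record Graph : Set₁ where
  field
    V    : Set
    E    : Set
    ends : E → V × V
open Graph public

BergeCopy : Graph → Hypergraph → Set
BergeCopy F H =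
  Σ (V F → Fin (n H)) λ φ → Injective _≡_ _≡_ φ ×
  Σ (E F → Fin (m H)) λ f → Injective _≡_ _≡_ f ×
    (∀ (x : E F) → (φ (proj₁ (ends F x)) ∈ edge H (f x))
                 × (φ (proj₂ (ends F x)) ∈ edge H (f x)))

BergeFree : Graph → Hypergraph → Set
BergeFree F H = ¬ BergeCopy F H

ShadowAdj : (H : Hypergraph) → Fin (n H) → Fin (n H) → Set
ShadowAdj H u v = u ≢ v × ∃[ e ] (u ∈ edge H e × v ∈ edge H e)

ShadowCopy : (F : Graph) (H : Hypergraph) → (V F → Fin (n H)) → Set
ShadowCopy F H ψ = Injective _≡_ _≡_ ψ ×
  (∀ (x : E F) → ShadowAdj H (ψ (proj₁ (ends F x))) (ψ (proj₂ (ends F x))))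

BergeTriangleCore : (H : Hypergraph) → Fin (n H) → Fin (n H) → Fin (n H) → Set
BergeTriangleCore H u v w =
  Σ (Fin (m H)) λ a → Σ (Fin (m H)) λ b → Σ (Fin (m H)) λ c →
    a ≢ b × b ≢ c × a ≢ c ×
    (u ∈ edge H a × v ∈ edge H a) ×
    (v ∈ edge H b × w ∈ edge H b) ×
    (u ∈ edge H c × w ∈ edge H c)

data BookV (s : ℕ) : Set where
  bu bv : BookV s
  bw    : Fin s → BookV s

data BookE (s : ℕ) : Set where
  buv : BookE s
  buw bvw : Fin s → BookE s

bookEnds : ∀ {s} → BookE s → BookV s × BookV s
bookEnds buv     = bu , bv
bookEnds (buw i) = bu , bw i
bookEnds (bvw i) = bv , bw i

Book : ℕ → Graph
Book s = record { V = BookV s ; E = BookE s ; ends = bookEnds }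

data FanV (s : ℕ) : Set where
  fu    : FanV s
  fv fw : Fin s → FanV s

data FanE (s : ℕ) : Set where
  fuv fuw fvw : Fin s → FanE s

fanEnds : ∀ {s} → FanE s → FanV s × FanV s
fanEnds (fuv i) = fu , fv i
fanEnds (fuw i) = fu , fw i
fanEnds (fvw i) = fv i , fw i

Fan : ℕ → Graph
Fan s = record { V = FanV s ; E = FanE s ; ends = fanEnds }

{-# OPTIONS --safe #-}
-- Index the 3rt Berge triangles of the shadow copy by i. A hyperedge has r vertices, so it
-- contains the private vertices (w_i for the book, v_i and w_i for the fan) of at most r
-- indices, and the three hyperedges of the i-th Berge triangle block at most 3r indices.
-- Greedily picking t indices, none blocked by an earlier pick, leaves t Berge triangles whose
-- hyperedges are pairwise distinct, and these assemble into a Berge copy of B_t or F_t.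
module Submission where

open import Defs
open import Data.Nat using (ℕ; zero; suc; _+_; _*_; _≤_; _<_; z≤n; s≤s; z<s)
open import Data.Nat.Properties
  using ( ≤-trans; ≤-<-trans; <⇒≱; m≤m+n; m<n+m; n≤1+n; +-suc; +-assoc; *-suc
        ; +-mono-≤; +-monoʳ-≤; +-monoˡ-≤; module ≤-Reasoning)
open import Data.Vec using ([]; _∷_; here; there; lookup; tabulate)
open import Data.Vec.Properties using (lookup∘tabulate; []=⇒lookup; lookup⇒[]=)
open import Data.Fin using (Fin; zero; suc)
import Data.Fin as Fin
open import Data.Fin.Properties using (suc-injective; 0≢1+n; <-cmp; ¬∀⟶∃¬)
open import Data.Fin.Subset using (Subset; inside; outside; _∈_; _∉_; _⊆_; _∪_; _-_; ⊥; ⊤; ∣_∣)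
open import Data.Fin.Subset.Properties
  using (_∈?_; ∣⊤∣≡n; ∣⊥∣≡0; p⊆q⇒∣p∣≤∣q∣; x∈p∪q⁺; x∈p∪q⁻; x∈p∧x≢y⇒x∈p-y; x∈p⇒∣p-x∣<∣p∣)
open import Data.Product using (Σ; _×_; _,_; proj₁; proj₂; ∃; uncurry)
open import Data.Sum using (_⊎_; inj₁; inj₂)
open import Data.Empty using (⊥-elim)
open import Function using (_∘_)
open import Function.Definitions using (Injective)
open import Relation.Binary using (tri<; tri≈; tri>)
open import Relation.Binary.PropositionalEquality using (_≡_; _≢_; refl; sym; trans; cong; cong₂; subst)
open import Relation.Nullary using (¬_)

∣p∪q∣≤∣p∣+∣q∣ : ∀ {n} (p q : Subset n) → ∣ p ∪ q ∣ ≤ ∣ p ∣ + ∣ q ∣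
∣p∪q∣≤∣p∣+∣q∣ []            []            = z≤n
∣p∪q∣≤∣p∣+∣q∣ (outside ∷ p) (outside ∷ q) = ∣p∪q∣≤∣p∣+∣q∣ p q
∣p∪q∣≤∣p∣+∣q∣ (outside ∷ p) (inside ∷ q)  =
  subst (suc ∣ p ∪ q ∣ ≤_) (sym (+-suc ∣ p ∣ ∣ q ∣)) (s≤s (∣p∪q∣≤∣p∣+∣q∣ p q))
∣p∪q∣≤∣p∣+∣q∣ (inside ∷ p)  (outside ∷ q) = s≤s (∣p∪q∣≤∣p∣+∣q∣ p q)
∣p∪q∣≤∣p∣+∣q∣ (inside ∷ p)  (inside ∷ q)  =
  s≤s (≤-trans (∣p∪q∣≤∣p∣+∣q∣ p q) (+-monoʳ-≤ ∣ p ∣ (n≤1+n ∣ q ∣)))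

∣p∣<n⇒∃∉ : ∀ {n} {p : Subset n} → ∣ p ∣ < n → ∃ (_∉ p)
∣p∣<n⇒∃∉ {n} {p} ∣p∣<n = ¬∀⟶∃¬ n (_∈ p) (_∈? p) λ all∈p →
  <⇒≱ ∣p∣<n (subst (_≤ ∣ p ∣) (∣⊤∣≡n n) (p⊆q⇒∣p∣≤∣q∣ {p = ⊤} {p} (λ {x} _ → all∈p x)))

∣p∣≤∣q∣-byUniqueWitnesses : ∀ {m n} {p : Subset m} {q : Subset n} (R : Fin m → Fin n → Set) →
  (∀ {x} → x ∈ p → ∃ λ y → y ∈ q × R x y) →
  (∀ {x x′ y} → R x y → R x′ y → x ≡ x′) →
  ∣ p ∣ ≤ ∣ q ∣
∣p∣≤∣q∣-byUniqueWitnesses {p = []} R witness unique = z≤n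
∣p∣≤∣q∣-byUniqueWitnesses {p = outside ∷ p} R witness unique =
  ∣p∣≤∣q∣-byUniqueWitnesses (R ∘ suc) (witness ∘ there) (λ r r′ → suc-injective (unique r r′))
∣p∣≤∣q∣-byUniqueWitnesses {p = inside ∷ p} {q} R witness unique with witness here
... | y₀ , y₀∈q , R₀y₀ = ≤-trans (s≤s rest) (x∈p⇒∣p-x∣<∣p∣ y₀∈q)
  where
  witness′ : ∀ {x} → x ∈ p → ∃ λ y → y ∈ q - y₀ × R (suc x) y
  witness′ x∈p with witness (there x∈p)
  ... | y , y∈q , Rxy = y , x∈p∧x≢y⇒x∈p-y y∈q (λ { refl → 0≢1+n (unique R₀y₀ Rxy) }) , Rxy

  rest : ∣ p ∣ ≤ ∣ q - y₀ ∣
  rest = ∣p∣≤∣q∣-byUniqueWitnesses (R ∘ suc) witness′ (λ r r′ → suc-injective (unique r r′))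

preimage : ∀ {m n} → (Fin m → Fin n) → Subset n → Subset m
preimage f q = tabulate (lookup q ∘ f)

∈-preimage⁺ : ∀ {m n} {f : Fin m → Fin n} {q x} → f x ∈ q → x ∈ preimage f q
∈-preimage⁺ {f = f} {q} {x} fx∈q =
  lookup⇒[]= x _ (trans (lookup∘tabulate (lookup q ∘ f) x) ([]=⇒lookup fx∈q))

∈-preimage⁻ : ∀ {m n} {f : Fin m → Fin n} {q x} → x ∈ preimage f q → f x ∈ q
∈-preimage⁻ {f = f} {q} {x} x∈f⁻¹q =
  lookup⇒[]= (f x) q (trans (sym (lookup∘tabulate (lookup q ∘ f) x)) ([]=⇒lookup x∈f⁻¹q))

m*n<m*[1+n] : ∀ {m} n → 0 < m → m * n < m * suc n
m*n<m*[1+n] {m} n 0<m = subst (m * n <_) (sym (*-suc m n)) (m<n+m (m * n) 0<m)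

record Selection {N} (blocks : Fin N → Subset N) (avoid : Subset N) (k : ℕ) : Set where
  field
    pick      : Fin k → Fin N
    avoids    : ∀ p → pick p ∉ avoid
    unblocked : ∀ {p q} → p Fin.< q → pick q ∉ blocks (pick p)
open Selection

module _ {N} {blocks : Fin N → Subset N} where

  noSelection : ∀ {Z} → Selection blocks Z 0
  noSelection .pick ()
  noSelection .avoids ()
  noSelection .unblocked {()}

  prepend : ∀ {Z k} i → i ∉ Z → Selection blocks (Z ∪ blocks i) k → Selection blocks Z (suc k)
  prepend i i∉Z S .pick zero                         = i
  prepend i i∉Z S .pick (suc p)                      = pick S p
  prepend i i∉Z S .avoids zero                       = i∉Z
  prepend i i∉Z S .avoids (suc p)                    = avoids S p ∘ x∈p∪q⁺ ∘ inj₁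
  prepend i i∉Z S .unblocked {zero}  {suc q} _       = avoids S q ∘ x∈p∪q⁺ ∘ inj₂
  prepend i i∉Z S .unblocked {suc p} {suc q} (s≤s p<q) = unblocked S p<q
  prepend i i∉Z S .unblocked {zero}  {zero}  ()
  prepend i i∉Z S .unblocked {suc p} {zero}  ()

  greedySelection : ∀ {K} → (∀ i → ∣ blocks i ∣ ≤ K) →
           ∀ t Z → ∣ Z ∣ + K * t < N → Selection blocks Z (suc t)
  greedySelection {K} small t Z bound with ∣p∣<n⇒∃∉ {p = Z} (≤-<-trans (m≤m+n ∣ Z ∣ (K * t)) bound)
  greedySelection {K} small zero    Z bound | i , i∉Z = prepend i i∉Z noSelection
  greedySelection {K} small (suc t) Z bound | i , i∉Z =
    prepend i i∉Z (greedySelection small t (Z ∪ blocks i) bound′)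
    where
    open ≤-Reasoning
    bound′ : ∣ Z ∪ blocks i ∣ + K * t < N
    bound′ = ≤-<-trans (begin
      ∣ Z ∪ blocks i ∣ + K * t  ≤⟨ +-monoˡ-≤ (K * t) (∣p∪q∣≤∣p∣+∣q∣ Z (blocks i)) ⟩
      ∣ Z ∣ + ∣ blocks i ∣ + K * t  ≤⟨ +-monoˡ-≤ (K * t) (+-monoʳ-≤ ∣ Z ∣ (small i)) ⟩
      ∣ Z ∣ + K + K * t  ≡⟨ +-assoc ∣ Z ∣ K (K * t) ⟩
      ∣ Z ∣ + (K + K * t)  ≡⟨ cong (∣ Z ∣ +_) (sym (*-suc K t)) ⟩
      ∣ Z ∣ + K * suc t  ∎) bound

data Side : Set where
  xy yz xz : Side

sideEnds : ∀ {A : Set} → A → A → A → Side → A × A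
sideEnds x y z xy = x , y
sideEnds x y z yz = y , z
sideEnds x y z xz = x , z

module _ {H : Hypergraph} {x y z : Fin (n H)} where

  coreEdge : BergeTriangleCore H x y z → Side → Fin (m H)
  coreEdge (a , _ , _ , _) xy = a
  coreEdge (_ , b , _ , _) yz = b
  coreEdge (_ , _ , c , _) xz = c

  coreEdge-injective : (core : BergeTriangleCore H x y z) → Injective _≡_ _≡_ (coreEdge core)
  coreEdge-injective _                           {xy} {xy} _ = refl
  coreEdge-injective _                           {yz} {yz} _ = refl
  coreEdge-injective _                           {xz} {xz} _ = refl
  coreEdge-injective (_ , _ , _ , a≢b , _)       {xy} {yz} e = ⊥-elim (a≢b e)
  coreEdge-injective (_ , _ , _ , a≢b , _)       {yz} {xy} e = ⊥-elim (a≢b (sym e))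
  coreEdge-injective (_ , _ , _ , _ , b≢c , _)   {yz} {xz} e = ⊥-elim (b≢c e)
  coreEdge-injective (_ , _ , _ , _ , b≢c , _)   {xz} {yz} e = ⊥-elim (b≢c (sym e))
  coreEdge-injective (_ , _ , _ , _ , _ , a≢c , _) {xy} {xz} e = ⊥-elim (a≢c e)
  coreEdge-injective (_ , _ , _ , _ , _ , a≢c , _) {xz} {xy} e = ⊥-elim (a≢c (sym e))

  coreEdge-∋ : (core : BergeTriangleCore H x y z) (s : Side) → let (u , v) = sideEnds x y z s in
    u ∈ edge H (coreEdge core s) × v ∈ edge H (coreEdge core s)
  coreEdge-∋ (_ , _ , _ , _ , _ , _ , x,y∈a , _)       xy = x,y∈a
  coreEdge-∋ (_ , _ , _ , _ , _ , _ , _ , y,z∈b , _)   yz = y,z∈b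
  coreEdge-∋ (_ , _ , _ , _ , _ , _ , _ , _ , x,z∈c)   xz = x,z∈c

-- hits e is meant to be the set of indices with a private vertex in the hyperedge e.
module BergeTriangles (H : Hypergraph) {N : ℕ} (x y z : Fin N → Fin (n H))
  (cores : ∀ i → BergeTriangleCore H (x i) (y i) (z i))
  (hits : Fin (m H) → Subset N) where

  triangleEdge : Fin N → Side → Fin (m H)
  triangleEdge i = coreEdge {H = H} {x i} {y i} {z i} (cores i)

  triangleEdge-injective : ∀ i → Injective _≡_ _≡_ (triangleEdge i)
  triangleEdge-injective i = coreEdge-injective {H = H} {x i} {y i} {z i} (cores i)

  triangleEdge-∋ : ∀ i s → let (u , v) = sideEnds (x i) (y i) (z i) s in
    u ∈ edge H (triangleEdge i s) × v ∈ edge H (triangleEdge i s)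
  triangleEdge-∋ i = coreEdge-∋ {H = H} {x i} {y i} {z i} (cores i)

  blocks : Fin N → Subset N
  blocks i = hits (triangleEdge i xy) ∪ (hits (triangleEdge i yz) ∪ hits (triangleEdge i xz))

  hits⊆blocks : ∀ i s → hits (triangleEdge i s) ⊆ blocks i
  hits⊆blocks i xy = x∈p∪q⁺ ∘ inj₁
  hits⊆blocks i yz = x∈p∪q⁺ ∘ inj₂ ∘ x∈p∪q⁺ ∘ inj₁
  hits⊆blocks i xz = x∈p∪q⁺ ∘ inj₂ ∘ x∈p∪q⁺ ∘ inj₂

  ∣blocks∣≤3r : ∀ {r} → (∀ e → ∣ hits e ∣ ≤ r) → ∀ i → ∣ blocks i ∣ ≤ 3 * r
  -- 3 * r normalises to r + (r + (r + 0)).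
  ∣blocks∣≤3r {r} small i = begin
    ∣ A ∪ (B ∪ C) ∣        ≤⟨ ∣p∪q∣≤∣p∣+∣q∣ A (B ∪ C) ⟩
    ∣ A ∣ + ∣ B ∪ C ∣      ≤⟨ +-monoʳ-≤ ∣ A ∣ (∣p∪q∣≤∣p∣+∣q∣ B C) ⟩
    ∣ A ∣ + (∣ B ∣ + ∣ C ∣)  ≤⟨ +-mono-≤ (small _) (+-mono-≤ (small _) (≤-trans (small _) (m≤m+n r 0))) ⟩
    3 * r                  ∎
    where
    open ≤-Reasoning
    A B C : Subset N
    A = hits (triangleEdge i xy)
    B = hits (triangleEdge i yz)
    C = hits (triangleEdge i xz)

  selection : ∀ {r} t → (∀ e → ∣ hits e ∣ ≤ r) → 3 * r * t < N → Selection blocks ⊥ (suc t)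
  selection {r} t small bound =
    greedySelection (∣blocks∣≤3r small) t ⊥ (subst (λ k → k + 3 * r * t < N) (sym (∣⊥∣≡0 N)) bound)

  module Picked {k} (S : Selection blocks ⊥ k) where

    earlier-edge≢later-edge : ∀ {p q} s s′ → p Fin.< q → pick S q ∈ hits (triangleEdge (pick S q) s′) →
      triangleEdge (pick S p) s ≢ triangleEdge (pick S q) s′
    earlier-edge≢later-edge {p} {q} s s′ p<q claim same =
      unblocked S p<q (hits⊆blocks (pick S p) s (subst (λ e → pick S q ∈ hits e) (sym same) claim))

    picked-edge-injective : ∀ {p q} s s′ →
      pick S p ∈ hits (triangleEdge (pick S p) s) → pick S q ∈ hits (triangleEdge (pick S q) s′) →
      triangleEdge (pick S p) s ≡ triangleEdge (pick S q) s′ → p ≡ q × s ≡ s′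
    picked-edge-injective {p} {q} s s′ claim claim′ same with <-cmp p q
    ... | tri< p<q _ _ = ⊥-elim (earlier-edge≢later-edge s s′ p<q claim′ same)
    ... | tri> _ _ q<p = ⊥-elim (earlier-edge≢later-edge s′ s q<p claim (sym same))
    ... | tri≈ _ refl _ = refl , triangleEdge-injective (pick S p) same

    pick-injective : ∀ s → (∀ i → i ∈ hits (triangleEdge i s)) → Injective _≡_ _≡_ (pick S)
    pick-injective s claim {p} {q} same =
      proj₁ (picked-edge-injective s s (claim (pick S p)) (claim (pick S q)) (cong (λ i → triangleEdge i s) same))

bw-injective : ∀ {s} → Injective _≡_ _≡_ (bw {s})
bw-injective refl = refl

subBook : ∀ {s N} → (Fin s → Fin N) → BookV s → BookV N
subBook g bu     = bu
subBook g bv     = bv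
subBook g (bw p) = bw (g p)

subBook-injective : ∀ {s N} {g : Fin s → Fin N} → Injective _≡_ _≡_ g → Injective _≡_ _≡_ (subBook g)
subBook-injective g-inj {bu}   {bu}   _    = refl
subBook-injective g-inj {bv}   {bv}   _    = refl
subBook-injective g-inj {bw p} {bw q} e    = cong bw (g-inj (bw-injective e))
subBook-injective g-inj {bu}   {bv}   ()
subBook-injective g-inj {bu}   {bw _} ()
subBook-injective g-inj {bv}   {bu}   ()
subBook-injective g-inj {bv}   {bw _} ()
subBook-injective g-inj {bw _} {bu}   ()
subBook-injective g-inj {bw _} {bv}   ()

module _ (H : Hypergraph) {r} (uniform : Uniform r H) (0<r : 0 < r) (t : ℕ)
  (ψ : BookV (3 * r * suc t) → Fin (n H)) (ψ-injective : Injective _≡_ _≡_ ψ)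
  (cores : ∀ i → BergeTriangleCore H (ψ bu) (ψ bv) (ψ (bw i))) where

  private
    hits : Fin (m H) → Subset (3 * r * suc t)
    hits e = preimage (ψ ∘ bw) (edge H e)

    ∣hits∣≤r : ∀ e → ∣ hits e ∣ ≤ r
    ∣hits∣≤r e = subst (∣ hits e ∣ ≤_) (uniform e)
      (∣p∣≤∣q∣-byUniqueWitnesses {p = hits e} {edge H e} (λ j v → ψ (bw j) ≡ v)
        (λ j∈hits → _ , ∈-preimage⁻ j∈hits , refl)
        (λ { refl same → bw-injective (ψ-injective (sym same)) }))

    open BergeTriangles H (λ _ → ψ bu) (λ _ → ψ bv) (ψ ∘ bw) cores hits

    S : Selection blocks ⊥ (suc t)
    S = selection t ∣hits∣≤r (m*n<m*[1+n] t (≤-trans 0<r (m≤m+n r _)))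

    open Picked S

    i∈hits-xz : ∀ i → i ∈ hits (triangleEdge i xz)
    i∈hits-xz i = ∈-preimage⁺ (proj₂ (triangleEdge-∋ i xz))

    i∈hits-yz : ∀ i → i ∈ hits (triangleEdge i yz)
    i∈hits-yz i = ∈-preimage⁺ (proj₂ (triangleEdge-∋ i yz))

    bergeEdge : BookE (suc t) → Fin (m H)
    bergeEdge buv     = triangleEdge (pick S zero) xy
    bergeEdge (buw p) = triangleEdge (pick S p) xz
    bergeEdge (bvw p) = triangleEdge (pick S p) yz

    -- The spine uv is carried by the first picked triangle, whose later pages avoid it.
    spine≢page : ∀ q s → s ≢ xy → pick S q ∈ hits (triangleEdge (pick S q) s) →
      triangleEdge (pick S zero) xy ≢ triangleEdge (pick S q) s
    spine≢page zero    s s≢xy _     same = s≢xy (sym (triangleEdge-injective (pick S zero) same))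
    spine≢page (suc q) s _    claim same = earlier-edge≢later-edge xy s z<s claim same

    bergeEdge-injective : Injective _≡_ _≡_ bergeEdge
    bergeEdge-injective {buv}   {buv}   _    = refl
    bergeEdge-injective {buv}   {buw q} same = ⊥-elim (spine≢page q xz (λ ()) (i∈hits-xz _) same)
    bergeEdge-injective {buv}   {bvw q} same = ⊥-elim (spine≢page q yz (λ ()) (i∈hits-yz _) same)
    bergeEdge-injective {buw p} {buv}   same = ⊥-elim (spine≢page p xz (λ ()) (i∈hits-xz _) (sym same))
    bergeEdge-injective {bvw p} {buv}   same = ⊥-elim (spine≢page p yz (λ ()) (i∈hits-yz _) (sym same))
    bergeEdge-injective {buw p} {buw q} same =
      cong buw (proj₁ (picked-edge-injective xz xz (i∈hits-xz _) (i∈hits-xz _) same))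
    bergeEdge-injective {bvw p} {bvw q} same =
      cong bvw (proj₁ (picked-edge-injective yz yz (i∈hits-yz _) (i∈hits-yz _) same))
    bergeEdge-injective {buw p} {bvw q} same
      with () ← proj₂ (picked-edge-injective xz yz (i∈hits-xz _) (i∈hits-yz _) same)
    bergeEdge-injective {bvw p} {buw q} same
      with () ← proj₂ (picked-edge-injective yz xz (i∈hits-yz _) (i∈hits-xz _) same)

    bergeEdge-covers : ∀ e → let (u , v) = bookEnds e in
      ψ (subBook (pick S) u) ∈ edge H (bergeEdge e) × ψ (subBook (pick S) v) ∈ edge H (bergeEdge e)
    bergeEdge-covers buv     = triangleEdge-∋ (pick S zero) xy
    bergeEdge-covers (buw p) = triangleEdge-∋ (pick S p) xz
    bergeEdge-covers (bvw p) = triangleEdge-∋ (pick S p) yz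

  bookCopy : BergeCopy (Book (suc t)) H
  bookCopy = ψ ∘ subBook (pick S)
           , (λ same → subBook-injective (pick-injective yz i∈hits-yz) (ψ-injective same))
           , bergeEdge , bergeEdge-injective , bergeEdge-covers

fv-injective : ∀ {s} → Injective _≡_ _≡_ (fv {s})
fv-injective refl = refl

fw-injective : ∀ {s} → Injective _≡_ _≡_ (fw {s})
fw-injective refl = refl

subFan : ∀ {s N} → (Fin s → Fin N) → FanV s → FanV N
subFan g fu     = fu
subFan g (fv p) = fv (g p)
subFan g (fw p) = fw (g p)

subFan-injective : ∀ {s N} {g : Fin s → Fin N} → Injective _≡_ _≡_ g → Injective _≡_ _≡_ (subFan g)
subFan-injective g-inj {fu}   {fu}   _ = refl
subFan-injective g-inj {fv p} {fv q} e = cong fv (g-inj (fv-injective e))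
subFan-injective g-inj {fw p} {fw q} e = cong fw (g-inj (fw-injective e))
subFan-injective g-inj {fu}   {fv _} ()
subFan-injective g-inj {fu}   {fw _} ()
subFan-injective g-inj {fv _} {fu}   ()
subFan-injective g-inj {fv _} {fw _} ()
subFan-injective g-inj {fw _} {fu}   ()
subFan-injective g-inj {fw _} {fv _} ()

fanEdge : ∀ {s} → FanE s → Fin s × Side
fanEdge (fuv p) = p , xy
fanEdge (fvw p) = p , yz
fanEdge (fuw p) = p , xz

fanEdge-injective : ∀ {s} → Injective _≡_ _≡_ (fanEdge {s})
fanEdge-injective {x = x} {y} same = trans (sym (from-fanEdge x)) (trans (cong from same) (from-fanEdge y))
  where
  from : Fin _ × Side → FanE _
  from (p , xy) = fuv p
  from (p , yz) = fvw p
  from (p , xz) = fuw p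

  from-fanEdge : ∀ e → from (fanEdge e) ≡ e
  from-fanEdge (fuv p) = refl
  from-fanEdge (fvw p) = refl
  from-fanEdge (fuw p) = refl

module _ (H : Hypergraph) {r} (uniform : Uniform r H) (0<r : 0 < r) (t : ℕ)
  (ψ : FanV (3 * r * suc t) → Fin (n H)) (ψ-injective : Injective _≡_ _≡_ ψ)
  (cores : ∀ i → BergeTriangleCore H (ψ fu) (ψ (fv i)) (ψ (fw i))) where

  private
    hits : Fin (m H) → Subset (3 * r * suc t)
    hits e = preimage (ψ ∘ fv) (edge H e) ∪ preimage (ψ ∘ fw) (edge H e)

    ∣hits∣≤r : ∀ e → ∣ hits e ∣ ≤ r
    ∣hits∣≤r e = subst (∣ hits e ∣ ≤_) (uniform e)
      (∣p∣≤∣q∣-byUniqueWitnesses {p = hits e} {edge H e} Private witness unique)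
      where
      Private : Fin (3 * r * suc t) → Fin (n H) → Set
      Private j v = ψ (fv j) ≡ v ⊎ ψ (fw j) ≡ v

      witness : ∀ {j} → j ∈ hits e → ∃ λ v → v ∈ edge H e × Private j v
      witness j∈hits with x∈p∪q⁻ _ _ j∈hits
      ... | inj₁ vⱼ∈e = _ , ∈-preimage⁻ vⱼ∈e , inj₁ refl
      ... | inj₂ wⱼ∈e = _ , ∈-preimage⁻ wⱼ∈e , inj₂ refl

      unique : ∀ {j j′ v} → Private j v → Private j′ v → j ≡ j′
      unique (inj₁ refl) (inj₁ same) = fv-injective (ψ-injective (sym same))
      unique (inj₂ refl) (inj₂ same) = fw-injective (ψ-injective (sym same))
      unique (inj₁ refl) (inj₂ same) with () ← ψ-injective same
      unique (inj₂ refl) (inj₁ same) with () ← ψ-injective same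

    open BergeTriangles H (λ _ → ψ fu) (ψ ∘ fv) (ψ ∘ fw) cores hits

    S : Selection blocks ⊥ (suc t)
    S = selection t ∣hits∣≤r (m*n<m*[1+n] t (≤-trans 0<r (m≤m+n r _)))

    open Picked S

    i∈hits : ∀ i s → i ∈ hits (triangleEdge i s)
    i∈hits i xy = x∈p∪q⁺ (inj₁ (∈-preimage⁺ (proj₂ (triangleEdge-∋ i xy))))
    i∈hits i yz = x∈p∪q⁺ (inj₂ (∈-preimage⁺ (proj₂ (triangleEdge-∋ i yz))))
    i∈hits i xz = x∈p∪q⁺ (inj₂ (∈-preimage⁺ (proj₂ (triangleEdge-∋ i xz))))

    bergeEdge : FanE (suc t) → Fin (m H)
    bergeEdge e = let (p , s) = fanEdge e in triangleEdge (pick S p) s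

    bergeEdge-injective : Injective _≡_ _≡_ bergeEdge
    bergeEdge-injective {e} {e′} same =
      let s = proj₂ (fanEdge e) ; s′ = proj₂ (fanEdge e′) in
      fanEdge-injective (uncurry (cong₂ _,_) (picked-edge-injective s s′ (i∈hits _ s) (i∈hits _ s′) same))

    bergeEdge-covers : ∀ e → let (u , v) = fanEnds e in
      ψ (subFan (pick S) u) ∈ edge H (bergeEdge e) × ψ (subFan (pick S) v) ∈ edge H (bergeEdge e)
    bergeEdge-covers (fuv p) = triangleEdge-∋ (pick S p) xy
    bergeEdge-covers (fvw p) = triangleEdge-∋ (pick S p) yz
    bergeEdge-covers (fuw p) = triangleEdge-∋ (pick S p) xz

  fanCopy : BergeCopy (Fan (suc t)) H
  fanCopy = ψ ∘ subFan (pick S)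
          , (λ same → subFan-injective (pick-injective xy (λ i → i∈hits i xy)) (ψ-injective same))
          , bergeEdge , bergeEdge-injective , bergeEdge-covers

proposition12 : (r t : ℕ) → 2 ≤ r → 1 ≤ t → (H : Hypergraph) → Uniform r H →
    (BergeFree (Book t) H →
      ¬ Σ (BookV (3 * r * t) → Fin (n H)) (λ ψ →
          ShadowCopy (Book (3 * r * t)) H ψ ×
          (∀ i → BergeTriangleCore H (ψ bu) (ψ bv) (ψ (bw i)))))
  × (BergeFree (Fan t) H →
      ¬ Σ (FanV (3 * r * t) → Fin (n H)) (λ ψ →
          ShadowCopy (Fan (3 * r * t)) H ψ ×
          (∀ i → BergeTriangleCore H (ψ fu) (ψ (fv i)) (ψ (fw i)))))
proposition12 r zero    _   ()
proposition12 r (suc t) 2≤r _ H uniform =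
    (λ bookFree (ψ , (ψ-injective , _) , cores) → bookFree (bookCopy H uniform 0<r t ψ ψ-injective cores))
  , (λ fanFree (ψ , (ψ-injective , _) , cores) → fanFree (fanCopy H uniform 0<r t ψ ψ-injective cores))
  where
  0<r : 0 < r
  0<r = ≤-trans (s≤s z≤n) 2≤r
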